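{- There exists $K$ such that for every integer $k\ge K$ there is a $k\times k$ matrix $M$ with all entries in $\{+1,-1\}$ such that for every row vector $\bar x\in\{+1,-1\}^k$, \[\#\Big\{1\le j\le k:\ |(\bar x M)_j|>\tfrac{\sqrt{k}}{20}\Big\}>\tfrac{k}{3}.\]
   Context: $(\bar x M)_j$ denotes the $j$-th entry of the row vector $\bar x M$, i.e. $\sum_{i=1}^k x_i m_{ij}$. -}

module Defs where

open import Data.Nat as ℕ using (ℕ; zero; suc; _<_; _<?_; _*_)
open import Data.Integer as ℤ using (ℤ; +_; -[1+_]; ∣_∣)
open import Data.Fin using (Fin; zero; suc)
open import Data.Sum using (_⊎_)
open import Relation.Binary.PropositionalEquality using (_≡_)
open import Relation.Nullary using (Dec; yes; no)

IsSign : ℤ → Set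
IsSign z = (z ≡ + 1) ⊎ (z ≡ -[1+ 0 ])

sumℤ : ∀ k → (Fin k → ℤ) → ℤ
sumℤ zero    f = + 0
sumℤ (suc k) f = f zero ℤ.+ sumℤ k (λ i → f (suc i))

count : ∀ {k} (P : Fin k → Set) → (∀ i → Dec (P i)) → ℕ
count {zero}  P d = 0
count {suc k} P d with d zero
... | yes _ = suc (count {k} (λ i → P (suc i)) (λ i → d (suc i)))
... | no  _ = count {k} (λ i → P (suc i)) (λ i → d (suc i))

rowTimes : ∀ {k} → (Fin k → ℤ) → (Fin k → Fin k → ℤ) → Fin k → ℤ
rowTimes {k} x M j = sumℤ k (λ i → x i ℤ.* M i j)

-- |s| > √k / 20  ⟺  k < 400 · |s|²   (both sides nonnegative; exact)
Large : ℕ → ℤ → Set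
Large k s = k < 400 * (∣ s ∣ * ∣ s ∣)

Large? : ∀ k s → Dec (Large k s)
Large? k s = k <? 400 * (∣ s ∣ * ∣ s ∣)

module Submission where

-- The proof is the first-moment (counting) method.  Encode a sign vector as a
-- Boolean vector and M by its columns c₁,…,c_k ∈ Bool^k; call c *small* for x
-- when 400 (x·c)² ≤ k, and let m = ⌈2k/3⌉.  We count column tuples that are
-- bad for some x, i.e. have at least m small columns for x:
--   * x·c is the sum of the coordinatewise product x ⊙ c, and c ↦ x ⊙ c
--     permutes the cube, so exactly s₀ = #{y : 400 (Σ y)² ≤ k} columns are
--     small for each x (translation invariance);
--   * union bound: at most 2^k s₀^m (2^k)^(k-m) tuples are bad for a given x;
--   * anti-concentration: 8 s₀ < 2^k, because the admissible numbers of −1's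
--     form a window of length c+1 with 400 c² ≤ k, each value attained by at
--     most 2·C(2h,h) vectors (k ∈ {2h, 2h+1}), and C(2h,h)² (3h+1) ≤ 16^h;
--   * since 2k ≤ 3m, summing over the 2^k vectors x leaves fewer than
--     (2^k)^k bad tuples, so some tuple is good for every x.

open import Defs
open import Data.Bool using (Bool; true; false; not; T)
open import Data.Empty using (⊥-elim)
open import Data.Fin using (Fin; zero; suc)
open import Data.Integer as ℤ using (ℤ; +_; -[1+_]; ∣_∣)
import Data.Integer.Properties as ℤP
import Data.Integer.Tactic.RingSolver as ℤRing
open import Data.Nat
  using (ℕ; zero; suc; _+_; _*_; _^_; _∸_; _≤_; _<_; _≥_; _≤ᵇ_; z≤n; s≤s; _≤?_; _<?_; NonZero; >-nonZero)
open import Data.Nat.Properties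
open import Data.Nat.Tactic.RingSolver using (solve-∀)
open import Data.Product using (Σ; _×_; _,_; proj₁; proj₂)
open import Data.Sum using (_⊎_; inj₁; inj₂; [_,_]′)
open import Data.Unit using (tt)
open import Data.Vec using (Vec; []; _∷_; lookup; tabulate; zipWith)
open import Data.Vec.Properties using (lookup∘tabulate)
open import Relation.Binary.PropositionalEquality
open import Relation.Nullary using (Dec; yes; no)

𝟙 : Bool → ℕ
𝟙 true  = 1
𝟙 false = 0

𝟙≡0⇒false : ∀ {b} → 𝟙 b ≡ 0 → b ≡ false
𝟙≡0⇒false {false} _ = refl

≤ᵇ-true⇒≤ : ∀ m n → (m ≤ᵇ n) ≡ true → m ≤ n
≤ᵇ-true⇒≤ m n e = ≤ᵇ⇒≤ m n (subst T (sym e) tt)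

≤ᵇ-false⇒> : ∀ m n → (m ≤ᵇ n) ≡ false → n < m
≤ᵇ-false⇒> m n e = ≰⇒> (λ m≤n → subst T e (≤⇒≤ᵇ m≤n))

>⇒≤ᵇ-false : ∀ m n → n < m → (m ≤ᵇ n) ≡ false
>⇒≤ᵇ-false m n n<m with m ≤ᵇ n in e
... | true  = ⊥-elim (<⇒≱ n<m (≤ᵇ-true⇒≤ m n e))
... | false = refl

≤ᵇ-suc : ∀ m n → (suc m ≤ᵇ suc n) ≡ (m ≤ᵇ n)
≤ᵇ-suc zero    n = refl
≤ᵇ-suc (suc m) n = refl

cubeSum : ∀ n → (Vec Bool n → ℕ) → ℕ
cubeSum zero    f = f []
cubeSum (suc n) f = cubeSum n (λ v → f (true ∷ v)) + cubeSum n (λ v → f (false ∷ v))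

cubeSum-cong : ∀ n {f g : Vec Bool n → ℕ} → (∀ v → f v ≡ g v) → cubeSum n f ≡ cubeSum n g
cubeSum-cong zero    f≡g = f≡g []
cubeSum-cong (suc n) f≡g =
  cong₂ _+_ (cubeSum-cong n (λ v → f≡g (true ∷ v))) (cubeSum-cong n (λ v → f≡g (false ∷ v)))

cubeSum-mono : ∀ n {f g : Vec Bool n → ℕ} → (∀ v → f v ≤ g v) → cubeSum n f ≤ cubeSum n g
cubeSum-mono zero    f≤g = f≤g []
cubeSum-mono (suc n) f≤g =
  +-mono-≤ (cubeSum-mono n (λ v → f≤g (true ∷ v))) (cubeSum-mono n (λ v → f≤g (false ∷ v)))

cubeSum-+ : ∀ n (f g : Vec Bool n → ℕ) → cubeSum n (λ v → f v + g v) ≡ cubeSum n f + cubeSum n g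
cubeSum-+ zero    f g = refl
cubeSum-+ (suc n) f g
  rewrite cubeSum-+ n (λ v → f (true ∷ v)) (λ v → g (true ∷ v))
        | cubeSum-+ n (λ v → f (false ∷ v)) (λ v → g (false ∷ v)) =
  interchange (cubeSum n (λ v → f (true ∷ v))) (cubeSum n (λ v → g (true ∷ v)))
              (cubeSum n (λ v → f (false ∷ v))) (cubeSum n (λ v → g (false ∷ v)))
  where
  interchange : ∀ a b c d → a + b + (c + d) ≡ a + c + (b + d)
  interchange = solve-∀

cubeSum-*ʳ : ∀ n (f : Vec Bool n → ℕ) c → cubeSum n (λ v → f v * c) ≡ cubeSum n f * c
cubeSum-*ʳ zero    f c = refl
cubeSum-*ʳ (suc n) f c
  rewrite cubeSum-*ʳ n (λ v → f (true ∷ v)) c | cubeSum-*ʳ n (λ v → f (false ∷ v)) c =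
  sym (*-distribʳ-+ c (cubeSum n (λ v → f (true ∷ v))) (cubeSum n (λ v → f (false ∷ v))))

double-* : ∀ a c → a * c + a * c ≡ (2 * a) * c
double-* = solve-∀

cubeSum-const : ∀ n c → cubeSum n (λ _ → c) ≡ 2 ^ n * c
cubeSum-const zero    c = sym (+-identityʳ c)
cubeSum-const (suc n) c rewrite cubeSum-const n c = double-* (2 ^ n) c

cubeSum-comm : ∀ n m (h : Vec Bool n → Vec Bool m → ℕ) →
  cubeSum n (λ u → cubeSum m (h u)) ≡ cubeSum m (λ v → cubeSum n (λ u → h u v))
cubeSum-comm zero    m h = refl
cubeSum-comm (suc n) m h
  rewrite cubeSum-comm n m (λ u → h (true ∷ u)) | cubeSum-comm n m (λ u → h (false ∷ u)) =
  sym (cubeSum-+ m (λ v → cubeSum n (λ u → h (true ∷ u) v)) (λ v → cubeSum n (λ u → h (false ∷ u) v)))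

cubeSum-<⇒small : ∀ n (f : Vec Bool n → ℕ) c → cubeSum n f < 2 ^ n * c → Σ (Vec Bool n) λ v → f v < c
cubeSum-<⇒small zero    f c lt = [] , subst (f [] <_) (+-identityʳ c) lt
cubeSum-<⇒small (suc n) f c lt
  with cubeSum n (λ v → f (true ∷ v)) <? 2 ^ n * c | cubeSum n (λ v → f (false ∷ v)) <? 2 ^ n * c
... | yes small₁ | _ = let (v , fv<c) = cubeSum-<⇒small n _ c small₁ in true ∷ v , fv<c
... | no _ | yes small₂ = let (v , fv<c) = cubeSum-<⇒small n _ c small₂ in false ∷ v , fv<c
... | no big₁ | no big₂ =
  ⊥-elim (<⇒≱ lt (subst (_≤ cubeSum (suc n) f) (double-* (2 ^ n) c) (+-mono-≤ (≮⇒≥ big₁) (≮⇒≥ big₂))))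

cubeSum-≡0 : ∀ n (f : Vec Bool n → ℕ) → cubeSum n f ≡ 0 → ∀ v → f v ≡ 0
cubeSum-≡0 zero    f eq []          = eq
cubeSum-≡0 (suc n) f eq (true ∷ v)  = cubeSum-≡0 n _ (m+n≡0⇒m≡0 _ eq) v
cubeSum-≡0 (suc n) f eq (false ∷ v) = cubeSum-≡0 n _ (m+n≡0⇒n≡0 _ eq) v

tupleSum : ∀ k n → (Vec (Vec Bool k) n → ℕ) → ℕ
tupleSum k zero    g = g []
tupleSum k (suc n) g = cubeSum k (λ c → tupleSum k n (λ cs → g (c ∷ cs)))

tupleSum-cong : ∀ k n {f g : Vec (Vec Bool k) n → ℕ} → (∀ cs → f cs ≡ g cs) → tupleSum k n f ≡ tupleSum k n g
tupleSum-cong k zero    f≡g = f≡g []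
tupleSum-cong k (suc n) f≡g = cubeSum-cong k (λ c → tupleSum-cong k n (λ cs → f≡g (c ∷ cs)))

tupleSum-const : ∀ k n c → tupleSum k n (λ _ → c) ≡ (2 ^ k) ^ n * c
tupleSum-const k zero    c = sym (+-identityʳ c)
tupleSum-const k (suc n) c = begin
  cubeSum k (λ _ → tupleSum k n (λ _ → c)) ≡⟨ cubeSum-cong k (λ _ → tupleSum-const k n c) ⟩
  cubeSum k (λ _ → (2 ^ k) ^ n * c)        ≡⟨ cubeSum-const k _ ⟩
  2 ^ k * ((2 ^ k) ^ n * c)                ≡⟨ *-assoc (2 ^ k) _ c ⟨
  (2 ^ k) ^ suc n * c                      ∎
  where open ≡-Reasoning

tupleSum-comm : ∀ k n m (h : Vec Bool m → Vec (Vec Bool k) n → ℕ) →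
  tupleSum k n (λ cs → cubeSum m (λ x → h x cs)) ≡ cubeSum m (λ x → tupleSum k n (h x))
tupleSum-comm k zero    m h = refl
tupleSum-comm k (suc n) m h =
  trans (cubeSum-cong k (λ c → tupleSum-comm k n m (λ x cs → h x (c ∷ cs))))
        (cubeSum-comm k m (λ c x → tupleSum k n (λ cs → h x (c ∷ cs))))

tupleSum-<⇒small : ∀ k n (g : Vec (Vec Bool k) n → ℕ) c → tupleSum k n g < (2 ^ k) ^ n * c →
  Σ (Vec (Vec Bool k) n) λ cs → g cs < c
tupleSum-<⇒small k zero    g c lt = [] , subst (g [] <_) (+-identityʳ c) lt
tupleSum-<⇒small k (suc n) g c lt =
  let (c₀ , small₀) = cubeSum-<⇒small k (λ c′ → tupleSum k n (λ cs → g (c′ ∷ cs))) ((2 ^ k) ^ n * c)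
                        (subst (tupleSum k (suc n) g <_) (*-assoc (2 ^ k) ((2 ^ k) ^ n) c) lt)
      (cs , small) = tupleSum-<⇒small k n (λ cs → g (c₀ ∷ cs)) c small₀
  in c₀ ∷ cs , small

hits : ∀ {k n} → (Vec Bool k → Bool) → Vec (Vec Bool k) n → ℕ
hits σ []       = 0
hits σ (c ∷ cs) = 𝟙 (σ c) + hits σ cs

atLeast : ∀ k n → (Vec Bool k → Bool) → ℕ → ℕ
atLeast k n σ m = tupleSum k n (λ cs → 𝟙 (m ≤ᵇ hits σ cs))

-- A tuple c ∷ cs has ≥ m+1 hits only if cs has ≥ m hits and σ c, or cs has ≥ m+1 hits.
atLeast-step : ∀ k n σ m c →
  tupleSum k n (λ cs → 𝟙 (suc m ≤ᵇ (𝟙 (σ c) + hits σ cs))) ≤ 𝟙 (σ c) * atLeast k n σ m + atLeast k n σ (suc m)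
atLeast-step k n σ m c with σ c
... | false = ≤-refl
... | true  = begin
  tupleSum k n (λ cs → 𝟙 (suc m ≤ᵇ suc (hits σ cs))) ≡⟨ tupleSum-cong k n (λ cs → cong 𝟙 (≤ᵇ-suc m (hits σ cs))) ⟩
  atLeast k n σ m                                    ≤⟨ m≤m+n _ _ ⟩
  atLeast k n σ m + atLeast k n σ (suc m)            ≡⟨ cong (_+ atLeast k n σ (suc m)) (*-identityˡ _) ⟨
  1 * atLeast k n σ m + atLeast k n σ (suc m)        ∎
  where open ≤-Reasoning

-- Union bound: if s points of Bool^k satisfy σ, then at most C(n,m) s^m (2^k)^(n-m)
-- ≤ 2^n s^m (2^k)^(n-m) n-tuples have at least m hits; we state it multiplied by
-- (2^k)^m to avoid truncated subtraction.
atLeast-bound : ∀ k n σ m →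
  (2 ^ k) ^ m * atLeast k n σ m ≤ 2 ^ n * cubeSum k (λ c → 𝟙 (σ c)) ^ m * (2 ^ k) ^ n
atLeast-bound k n       σ zero = begin
  1 * tupleSum k n (λ _ → 1) ≡⟨ trans (*-identityˡ _) (tupleSum-const k n 1) ⟩
  (2 ^ k) ^ n * 1            ≡⟨ *-comm _ 1 ⟩
  1 * (2 ^ k) ^ n            ≤⟨ *-monoˡ-≤ ((2 ^ k) ^ n) (*-monoˡ-≤ 1 (m^n>0 2 n)) ⟩
  2 ^ n * 1 * (2 ^ k) ^ n    ∎
  where open ≤-Reasoning
atLeast-bound k zero    σ (suc m) = ≤-trans (≤-reflexive (*-zeroʳ ((2 ^ k) ^ suc m))) z≤n
atLeast-bound k (suc n) σ (suc m) = begin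
    a ^ suc m * atLeast k (suc n) σ (suc m)
  ≤⟨ *-monoʳ-≤ (a ^ suc m) (cubeSum-mono k (atLeast-step k n σ m)) ⟩
    a ^ suc m * cubeSum k (λ c → 𝟙 (σ c) * X + Y)
  ≡⟨ cong (a ^ suc m *_) (trans (cubeSum-+ k (λ c → 𝟙 (σ c) * X) (λ _ → Y))
                                (cong₂ _+_ (cubeSum-*ʳ k (λ c → 𝟙 (σ c)) X) (cubeSum-const k Y))) ⟩
    a ^ suc m * (s * X + a * Y)
  ≡⟨ regroup a (a ^ m) s X Y ⟩
    a * s * (a ^ m * X) + a * (a ^ suc m * Y)
  ≤⟨ +-mono-≤ (*-monoʳ-≤ (a * s) (atLeast-bound k n σ m)) (*-monoʳ-≤ a (atLeast-bound k n σ (suc m))) ⟩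
    a * s * (2 ^ n * s ^ m * a ^ n) + a * (2 ^ n * (s * s ^ m) * a ^ n)
  ≡⟨ collect a s (2 ^ n) (s ^ m) (a ^ n) ⟩
    2 ^ suc n * s ^ suc m * a ^ suc n ∎
  where
  open ≤-Reasoning
  a = 2 ^ k
  s = cubeSum k (λ c → 𝟙 (σ c))
  X = atLeast k n σ m
  Y = atLeast k n σ (suc m)
  regroup : ∀ a am s X Y → (a * am) * (s * X + a * Y) ≡ a * s * (am * X) + a * ((a * am) * Y)
  regroup = solve-∀
  collect : ∀ a s p sm an → a * s * (p * sm * an) + a * (p * (s * sm) * an) ≡ (2 * p) * (s * sm) * (a * an)
  collect = solve-∀

binom : ℕ → ℕ → ℕ
binom _       zero    = 1
binom zero    (suc r) = 0
binom (suc n) (suc r) = binom n r + binom n (suc r)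

binom-> : ∀ n r → n < r → binom n r ≡ 0
binom-> zero    (suc r) _         = refl
binom-> (suc n) (suc r) (s≤s n<r) rewrite binom-> n r n<r | binom-> n (suc r) (m<n⇒m<1+n n<r) = refl

binom-pos : ∀ n r → r ≤ n → 1 ≤ binom n r
binom-pos n       zero    _         = s≤s z≤n
binom-pos (suc n) (suc r) (s≤s r≤n) = ≤-trans (binom-pos n r r≤n) (m≤m+n _ _)

≤-or-beyond : ∀ s m → m ≤ s ⊎ Σ ℕ λ t → m ≡ suc (s + t)
≤-or-beyond s m with m ≤? s
... | yes m≤s = inj₁ m≤s
... | no  m≰s = inj₂ (m ∸ suc s , sym (m+[n∸m]≡n (≰⇒> m≰s)))

binom-ratio : ∀ m r → suc r * binom m (suc r) ≡ (m ∸ r) * binom m r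
binom-ratio zero    zero    = refl
binom-ratio zero    (suc r) = *-zeroʳ (suc (suc r))
binom-ratio (suc m) zero    = begin
  1 * binom (suc m) 1 ≡⟨ *-identityˡ _ ⟩
  suc (binom m 1)     ≡⟨ cong suc (trans (sym (*-identityˡ _)) (trans (binom-ratio m 0) (*-identityʳ m))) ⟩
  suc m               ≡⟨ *-identityʳ (suc m) ⟨
  suc m * 1           ∎
  where open ≡-Reasoning
binom-ratio (suc m) (suc s) = step m s (binom-ratio m s) (binom-ratio m (suc s))
  where
  step : ∀ m s → suc s * binom m (suc s) ≡ (m ∸ s) * binom m s →
                 suc (suc s) * binom m (suc (suc s)) ≡ (m ∸ suc s) * binom m (suc s) →
    suc (suc s) * (binom m (suc s) + binom m (suc (suc s))) ≡ (m ∸ s) * (binom m s + binom m (suc s))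
  step m s ih₁ ih₂ with ≤-or-beyond s m
  ... | inj₁ m≤s
    rewrite binom-> m (suc s) (s≤s m≤s) | binom-> m (suc (suc s)) (s≤s (m≤n⇒m≤1+n m≤s))
          | m≤n⇒m∸n≡0 m≤s | *-zeroʳ (suc (suc s)) = refl
  ... | inj₂ (t , refl) = begin
      suc (suc s) * (B₁ + B₂)       ≡⟨ *-distribˡ-+ (suc (suc s)) B₁ B₂ ⟩
      suc (suc s) * B₁ + suc (suc s) * B₂
        ≡⟨ cong (_+_ (suc (suc s) * B₁)) (trans ih₂ (cong (_* B₁) (m+n∸m≡n s t))) ⟩
      suc (suc s) * B₁ + t * B₁     ≡⟨ shift s t B₁ ⟩
      suc s * B₁ + suc t * B₁       ≡⟨ cong (_+ suc t * B₁) (trans ih₁ (cong (_* B₀) m∸s)) ⟩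
      suc t * B₀ + suc t * B₁       ≡⟨ *-distribˡ-+ (suc t) B₀ B₁ ⟨
      suc t * (B₀ + B₁)             ≡⟨ cong (_* (B₀ + B₁)) m∸s ⟨
      (suc (s + t) ∸ s) * (B₀ + B₁) ∎
    where
    open ≡-Reasoning
    B₀ = binom (suc (s + t)) s
    B₁ = binom (suc (s + t)) (suc s)
    B₂ = binom (suc (s + t)) (suc (suc s))
    m∸s : suc (s + t) ∸ s ≡ suc t
    m∸s = trans (cong (_∸ s) (sym (+-suc s t))) (m+n∸m≡n s (suc t))
    shift : ∀ s t x → (2 + s) * x + t * x ≡ (1 + s) * x + (1 + t) * x
    shift = solve-∀

binom-absorb : ∀ m r → suc r * binom (suc m) (suc r) ≡ suc m * binom m r
binom-absorb m r with ≤-or-beyond r m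
... | inj₁ m≤r with m ≟ r
...   | yes refl = cong (suc r *_) (trans (cong (_+_ (binom r r)) (binom-> r (suc r) ≤-refl)) (+-identityʳ _))
...   | no  m≢r
  rewrite binom-> m r (≤∧≢⇒< m≤r m≢r) | binom-> m (suc r) (m<n⇒m<1+n (≤∧≢⇒< m≤r m≢r))
        | *-zeroʳ (suc r) | *-zeroʳ (suc m) = refl
binom-absorb m r | inj₂ (t , refl) = begin
  suc r * (binom m r + binom m (suc r))        ≡⟨ *-distribˡ-+ (suc r) (binom m r) (binom m (suc r)) ⟩
  suc r * binom m r + suc r * binom m (suc r)  ≡⟨ cong (_+_ (suc r * binom m r)) (binom-ratio m r) ⟩
  suc r * binom m r + (m ∸ r) * binom m r      ≡⟨ *-distribʳ-+ (binom m r) (suc r) (m ∸ r) ⟨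
  (suc r + (m ∸ r)) * binom m r                ≡⟨ cong (λ t → suc t * binom m r) (m+[n∸m]≡n r≤m) ⟩
  suc m * binom m r                            ∎
  where
  open ≡-Reasoning
  r≤m : r ≤ suc (r + t)
  r≤m = ≤-trans (m≤m+n r t) (n≤1+n _)

binom-up : ∀ h r → r < h → binom (h + h) r ≤ binom (h + h) (suc r)
binom-up h r r<h = *-cancelˡ-≤ (suc r) (begin
  suc r * binom (h + h) r           ≤⟨ *-monoˡ-≤ (binom (h + h) r) (≤-trans r<h h≤2h∸r) ⟩
  ((h + h) ∸ r) * binom (h + h) r   ≡⟨ binom-ratio (h + h) r ⟨
  suc r * binom (h + h) (suc r)     ∎)
  where
  open ≤-Reasoning
  h≤2h∸r : h ≤ (h + h) ∸ r
  h≤2h∸r = ≤-trans (m≤m+n h (h ∸ r)) (≤-reflexive (sym (+-∸-assoc h (<⇒≤ r<h))))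

binom-down : ∀ h r → h ≤ r → binom (h + h) (suc r) ≤ binom (h + h) r
binom-down h r h≤r = *-cancelˡ-≤ (suc r) (begin
  suc r * binom (h + h) (suc r)     ≡⟨ binom-ratio (h + h) r ⟩
  ((h + h) ∸ r) * binom (h + h) r   ≤⟨ *-monoˡ-≤ (binom (h + h) r) 2h∸r≤1+r ⟩
  suc r * binom (h + h) r           ∎)
  where
  open ≤-Reasoning
  2h∸r≤1+r : (h + h) ∸ r ≤ suc r
  2h∸r≤1+r = ≤-trans (∸-monoʳ-≤ (h + h) h≤r) (≤-trans (≤-reflexive (m+n∸n≡m h h)) (≤-trans h≤r (n≤1+n r)))

binom-central-max : ∀ h r → binom (h + h) r ≤ binom (h + h) h
binom-central-max h r with ≤-or-beyond h r
... | inj₁ r≤h          = rising (h ∸ r) r (m+[n∸m]≡n r≤h)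
  where
  rising : ∀ d r → r + d ≡ h → binom (h + h) r ≤ binom (h + h) h
  rising zero    r eq rewrite +-identityʳ r | eq = ≤-refl
  rising (suc d) r eq = ≤-trans (binom-up h r (subst (r <_) eq (m<m+n r (s≤s z≤n))))
                                (rising d (suc r) (trans (sym (+-suc r d)) eq))
... | inj₂ (t , refl) = subst (λ x → binom (h + h) x ≤ binom (h + h) h) (+-suc h t) (falling (suc t))
  where
  falling : ∀ d → binom (h + h) (h + d) ≤ binom (h + h) h
  falling zero    rewrite +-identityʳ h = ≤-refl
  falling (suc d) rewrite +-suc h d = ≤-trans (binom-down h (h + d) (m≤m+n h d)) (falling d)

central : ℕ → ℕ
central h = binom (h + h) h

-- (h+1)·C(2h+2, h+1) = 2(2h+1)·C(2h, h), from two absorptions and the symmetry C(2h+1,h+1) = C(2h+1,h).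
central-step : ∀ h → suc h * central (suc h) ≡ 2 * suc (h + h) * central h
central-step h = *-cancelˡ-≡ _ _ (suc h) (begin
  suc h * (suc h * central (suc h))       ≡⟨ cong (λ x → suc h * (suc h * binom x (suc h))) (cong suc (+-suc h h)) ⟩
  suc h * (suc h * binom (suc n) (suc h)) ≡⟨ cong (suc h *_) (binom-absorb n h) ⟩
  suc h * (suc n * binom n h)             ≡⟨ swap (suc h) (suc n) (binom n h) ⟩
  suc n * (suc h * binom n h)             ≡⟨ cong (suc n *_) symmetry ⟨
  suc n * (suc h * binom n (suc h))       ≡⟨ cong (suc n *_) (binom-absorb (h + h) h) ⟩
  suc n * (n * central h)                 ≡⟨ collect h (central h) ⟩
  suc h * (2 * suc (h + h) * central h)   ∎)
  where
  open ≡-Reasoning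
  n = suc (h + h)
  symmetry : suc h * binom n (suc h) ≡ suc h * binom n h
  symmetry = trans (binom-ratio n h) (cong (_* binom n h) (m+n∸n≡m (suc h) h))
  swap : ∀ a c x → a * (c * x) ≡ c * (a * x)
  swap = solve-∀
  collect : ∀ h x → (2 + (h + h)) * ((1 + (h + h)) * x) ≡ (1 + h) * (2 * (1 + (h + h)) * x)
  collect = solve-∀

-- C(2h,h)² (3h+1) ≤ 16^h, i.e. C(2h,h) ≤ 4^h/√(3h+1); the induction step rests on
-- (2(2h+1))² (3h+4) ≤ 16 (h+1)² (3h+1).
central-bound : ∀ h → central h * central h * (3 * h + 1) ≤ 16 ^ h
central-bound zero    = ≤-refl
central-bound (suc h) = *-cancelˡ-≤ (suc h * suc h) (begin
    suc h * suc h * (B′ * B′ * (3 * suc h + 1))                  ≡⟨ regroup (suc h) B′ (3 * suc h + 1) ⟩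
    (suc h * B′) * (suc h * B′) * (3 * suc h + 1)               ≡⟨ cong (λ x → x * x * (3 * suc h + 1)) (central-step h) ⟩
    (2 * suc (h + h) * B) * (2 * suc (h + h) * B) * (3 * suc h + 1)
      ≤⟨ m≤m+n _ (4 * h * (B * B)) ⟩
    (2 * suc (h + h) * B) * (2 * suc (h + h) * B) * (3 * suc h + 1) + 4 * h * (B * B)
      ≡⟨ expand h B ⟩
    16 * (suc h * suc h) * (B * B * (3 * h + 1))                 ≤⟨ *-monoʳ-≤ (16 * (suc h * suc h)) (central-bound h) ⟩
    16 * (suc h * suc h) * 16 ^ h                                ≡⟨ shuffle (suc h * suc h) (16 ^ h) ⟩
    suc h * suc h * 16 ^ suc h                                   ∎)
  where
  open ≤-Reasoning
  B  = central h
  B′ = central (suc h)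
  regroup : ∀ a x c → a * a * (x * x * c) ≡ (a * x) * (a * x) * c
  regroup = solve-∀
  expand : ∀ h x → (2 * (1 + (h + h)) * x) * (2 * (1 + (h + h)) * x) * (3 * (1 + h) + 1) + 4 * h * (x * x)
                   ≡ 16 * ((1 + h) * (1 + h)) * (x * x * (3 * h + 1))
  expand = solve-∀
  shuffle : ∀ a p → 16 * a * p ≡ a * (16 * p)
  shuffle = solve-∀

half : ∀ n → Σ ℕ λ h → (n ≡ h + h) ⊎ (n ≡ suc (h + h))
half zero = 0 , inj₁ refl
half (suc n) with half n
... | h , inj₁ eq = h , inj₂ (cong suc eq)
... | h , inj₂ eq = suc h , inj₁ (trans (cong suc eq) (cong suc (sym (+-suc h h))))

binom-max : ∀ n h → (n ≡ h + h) ⊎ (n ≡ suc (h + h)) → ∀ w → binom n w ≤ 2 * central h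
binom-max n h (inj₁ refl) w       = ≤-trans (binom-central-max h w) (m≤m+n (central h) _)
binom-max n h (inj₂ refl) zero    = ≤-trans (binom-pos (h + h) h (m≤n+m h h)) (m≤m+n (central h) _)
binom-max n h (inj₂ refl) (suc w) =
  ≤-trans (+-mono-≤ (binom-central-max h w) (binom-central-max h (suc w)))
          (≤-reflexive (cong (_+_ (central h)) (sym (+-identityʳ (central h)))))

falses : ∀ {n} → Vec Bool n → ℕ
falses []          = 0
falses (true ∷ v)  = falses v
falses (false ∷ v) = suc (falses v)

rangeSum : ℕ → (ℕ → ℕ) → ℕ
rangeSum zero    f = 0
rangeSum (suc L) f = f 0 + rangeSum L (λ w → f (suc w))

rangeSum-cong : ∀ L {f g : ℕ → ℕ} → (∀ w → f w ≡ g w) → rangeSum L f ≡ rangeSum L g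
rangeSum-cong zero    f≡g = refl
rangeSum-cong (suc L) f≡g = cong₂ _+_ (f≡g 0) (rangeSum-cong L (λ w → f≡g (suc w)))

rangeSum-mono : ∀ L {f g : ℕ → ℕ} → (∀ w → f w ≤ g w) → rangeSum L f ≤ rangeSum L g
rangeSum-mono zero    f≤g = ≤-refl
rangeSum-mono (suc L) f≤g = +-mono-≤ (f≤g 0) (rangeSum-mono L (λ w → f≤g (suc w)))

rangeSum-*ʳ : ∀ L f c → rangeSum L (λ w → f w * c) ≡ rangeSum L f * c
rangeSum-*ʳ zero    f c = refl
rangeSum-*ʳ (suc L) f c rewrite rangeSum-*ʳ L (λ w → f (suc w)) c =
  sym (*-distribʳ-+ c (f 0) (rangeSum L (λ w → f (suc w))))

rangeSum-+ : ∀ L f g → rangeSum L (λ w → f w + g w) ≡ rangeSum L f + rangeSum L g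
rangeSum-+ zero    f g = refl
rangeSum-+ (suc L) f g rewrite rangeSum-+ L (λ w → f (suc w)) (λ w → g (suc w)) =
  interchange (f 0) (g 0) (rangeSum L (λ w → f (suc w))) (rangeSum L (λ w → g (suc w)))
  where
  interchange : ∀ a b c d → a + b + (c + d) ≡ a + c + (b + d)
  interchange = solve-∀

rangeSum-zero : ∀ L → rangeSum L (λ _ → 0) ≡ 0
rangeSum-zero zero    = refl
rangeSum-zero (suc L) = rangeSum-zero L

-- Exactly C(n,w) points of Bool^n have w false coordinates, so a property of the
-- weight is counted by a weighted sum over w < L (any L > n).
weight-distribution : ∀ n (Q : ℕ → Bool) L → n < L →
  cubeSum n (λ y → 𝟙 (Q (falses y))) ≡ rangeSum L (λ w → 𝟙 (Q w) * binom n w)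
weight-distribution zero    Q (suc L) _ = sym (begin
  𝟙 (Q 0) * 1 + rangeSum L (λ w → 𝟙 (Q (suc w)) * 0)
    ≡⟨ cong₂ _+_ (*-identityʳ (𝟙 (Q 0))) (trans (rangeSum-cong L (λ w → *-zeroʳ (𝟙 (Q (suc w))))) (rangeSum-zero L)) ⟩
  𝟙 (Q 0) + 0 ≡⟨ +-identityʳ _ ⟩
  𝟙 (Q 0)     ∎)
  where open ≡-Reasoning
weight-distribution (suc n) Q (suc L) (s≤s n<L) = begin
    cubeSum n (λ v → 𝟙 (Q (falses v))) + cubeSum n (λ v → 𝟙 (Q (suc (falses v))))
  ≡⟨ cong₂ _+_ (weight-distribution n Q (suc L) (m<n⇒m<1+n n<L)) (weight-distribution n (λ w → Q (suc w)) L n<L) ⟩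
    (𝟙 (Q 0) * 1 + A) + B
  ≡⟨ reorder (𝟙 (Q 0) * 1) A B ⟩
    𝟙 (Q 0) * 1 + (B + A)
  ≡⟨ cong (_+_ (𝟙 (Q 0) * 1)) pascal ⟨
    𝟙 (Q 0) * 1 + rangeSum L (λ w → 𝟙 (Q (suc w)) * (binom n w + binom n (suc w)))
  ∎
  where
  open ≡-Reasoning
  A = rangeSum L (λ w → 𝟙 (Q (suc w)) * binom n (suc w))
  B = rangeSum L (λ w → 𝟙 (Q (suc w)) * binom n w)
  pascal : rangeSum L (λ w → 𝟙 (Q (suc w)) * (binom n w + binom n (suc w))) ≡ B + A
  pascal = trans (rangeSum-cong L (λ w → *-distribˡ-+ (𝟙 (Q (suc w))) (binom n w) (binom n (suc w)))) (rangeSum-+ L _ _)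
  reorder : ∀ x a b → (x + a) + b ≡ x + (b + a)
  reorder = solve-∀

spread : ∀ N (Q : ℕ → Bool) c → rangeSum N (λ w → 𝟙 (Q w)) ≡ suc c →
  Σ ℕ λ f → Σ ℕ λ l → Q f ≡ true × Q l ≡ true × f + c ≤ l
spread zero    Q c ()
spread (suc N) Q c eq with Q 0 in Q0
... | false = let (f , l , Qf , Ql , f+c≤l) = spread N (λ w → Q (suc w)) c eq in suc f , suc l , Qf , Ql , s≤s f+c≤l
... | true with rangeSum N (λ w → 𝟙 (Q (suc w))) in rest
...   | zero rewrite sym (suc-injective eq) = 0 , 0 , Q0 , Q0 , z≤n
...   | suc c′ = let (f , l , Qf , Ql , f+c′≤l) = spread N (λ w → Q (suc w)) c′ rest in
                 0 , suc l , Q0 , Ql , subst (_≤ suc l) (suc-injective eq) (s≤s (≤-trans (m≤n+m c′ f) f+c′≤l))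

square-sum≤ : ∀ a b → (a + b) * (a + b) ≤ 2 * (a * a + b * b)
square-sum≤ a b = [ ordered a b , swapped ]′ (≤-total a b)
  where
  identity : ∀ a e → (a + (a + e)) * (a + (a + e)) + e * e ≡ 2 * (a * a + (a + e) * (a + e))
  identity = solve-∀
  ordered : ∀ a b → a ≤ b → (a + b) * (a + b) ≤ 2 * (a * a + b * b)
  ordered a b a≤b = subst (λ t → (a + t) * (a + t) ≤ 2 * (a * a + t * t)) (m+[n∸m]≡n a≤b)
                          (≤-trans (m≤m+n _ ((b ∸ a) * (b ∸ a))) (≤-reflexive (identity a (b ∸ a))))
  swapped : b ≤ a → (a + b) * (a + b) ≤ 2 * (a * a + b * b)
  swapped b≤a = subst₂ _≤_ (cong (λ t → t * t) (+-comm b a)) (cong (2 *_) (+-comm (b * b) (a * a))) (ordered b a b≤a)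

close-pair : ∀ p k c d₁ d₂ → p * (d₁ * d₁) ≤ k → p * (d₂ * d₂) ≤ k → 2 * c ≤ d₁ + d₂ → p * (c * c) ≤ k
close-pair p k c d₁ d₂ h₁ h₂ 2c≤d = *-cancelˡ-≤ 4 (begin
  4 * (p * (c * c))                   ≡⟨ rescale p c ⟩
  p * ((2 * c) * (2 * c))             ≤⟨ *-monoʳ-≤ p (*-mono-≤ 2c≤d 2c≤d) ⟩
  p * ((d₁ + d₂) * (d₁ + d₂))         ≤⟨ *-monoʳ-≤ p (square-sum≤ d₁ d₂) ⟩
  p * (2 * (d₁ * d₁ + d₂ * d₂))       ≡⟨ distribute p (d₁ * d₁) (d₂ * d₂) ⟩
  2 * (p * (d₁ * d₁)) + 2 * (p * (d₂ * d₂)) ≤⟨ +-mono-≤ (*-monoʳ-≤ 2 h₁) (*-monoʳ-≤ 2 h₂) ⟩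
  2 * k + 2 * k                       ≡⟨ double k ⟩
  4 * k                               ∎)
  where
  open ≤-Reasoning
  rescale : ∀ p c → 4 * (p * (c * c)) ≡ p * ((2 * c) * (2 * c))
  rescale = solve-∀
  distribute : ∀ p x y → p * (2 * (x + y)) ≡ 2 * (p * x) + 2 * (p * y)
  distribute = solve-∀
  double : ∀ k → 2 * k + 2 * k ≡ 4 * k
  double = solve-∀

sign : Bool → ℤ
sign true  = + 1
sign false = -[1+ 0 ]

signSum : ∀ {n} → Vec Bool n → ℤ
signSum []      = + 0
signSum (b ∷ v) = sign b ℤ.+ signSum v

imbalance : ℕ → ℕ → ℤ
imbalance n w = + n ℤ.- + (2 * w)

signSum-falses : ∀ {n} (y : Vec Bool n) → signSum y ≡ imbalance n (falses y)
signSum-falses []                = refl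
signSum-falses {suc n} (true ∷ y) rewrite signSum-falses y = shift (+ n) (+ (2 * falses y))
  where
  shift : ∀ a b → + 1 ℤ.+ (a ℤ.- b) ≡ (+ 1 ℤ.+ a) ℤ.- b
  shift = ℤRing.solve-∀
signSum-falses {suc n} (false ∷ y) rewrite signSum-falses y =
  trans (shift (+ n) (+ (falses y)))
        (cong (λ t → (+ 1 ℤ.+ + n) ℤ.- + t) (cong suc (sym (+-suc (falses y) (falses y + 0)))))
  where
  shift : ∀ a b → -[1+ 0 ] ℤ.+ (a ℤ.- (b ℤ.+ (b ℤ.+ + 0))) ≡ (+ 1 ℤ.+ a) ℤ.- (+ 2 ℤ.+ (b ℤ.+ (b ℤ.+ + 0)))
  shift = ℤRing.solve-∀

imbalance-gap : ∀ n f l c → f + c ≤ l → 2 * c ≤ ∣ imbalance n f ∣ + ∣ imbalance n l ∣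
imbalance-gap n f l c f+c≤l = begin
  2 * c                                   ≡⟨ m+n∸m≡n (2 * f) (2 * c) ⟨
  (2 * f + 2 * c) ∸ 2 * f                 ≡⟨ cong (_∸ 2 * f) (*-distribˡ-+ 2 f c) ⟨
  2 * (f + c) ∸ 2 * f                     ≤⟨ ∸-monoˡ-≤ (2 * f) (*-monoʳ-≤ 2 f+c≤l) ⟩
  2 * l ∸ 2 * f                           ≡⟨ difference ⟨
  ∣ imbalance n f ℤ.- imbalance n l ∣      ≤⟨ ℤP.∣i-j∣≤∣i∣+∣j∣ (imbalance n f) (imbalance n l) ⟩
  ∣ imbalance n f ∣ + ∣ imbalance n l ∣    ∎
  where
  open ≤-Reasoning
  cancel : ∀ a x y → (a ℤ.- x) ℤ.- (a ℤ.- y) ≡ y ℤ.- x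
  cancel = ℤRing.solve-∀
  difference : ∣ imbalance n f ℤ.- imbalance n l ∣ ≡ 2 * l ∸ 2 * f
  difference = cong ∣_∣ (trans (cancel (+ n) (+ (2 * f)) (+ (2 * l)))
                        (trans (ℤP.m-n≡m⊖n (2 * l) (2 * f)) (ℤP.⊖-≥ (*-monoʳ-≤ 2 (≤-trans (m≤m+n f c) f+c≤l)))))

balanced : ∀ k → Vec Bool k → Bool
balanced k y = 400 * (∣ signSum y ∣ * ∣ signSum y ∣) ≤ᵇ k

admissible : ℕ → ℕ → Bool
admissible k w = 400 * (∣ imbalance k w ∣ * ∣ imbalance k w ∣) ≤ᵇ k

balanced-falses : ∀ k (y : Vec Bool k) → balanced k y ≡ admissible k (falses y)
balanced-falses k y rewrite signSum-falses y = refl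

admissible-window : ∀ k f l c → admissible k f ≡ true → admissible k l ≡ true → f + c ≤ l → 400 * (c * c) ≤ k
admissible-window k f l c adm-f adm-l f+c≤l =
  close-pair 400 k c ∣ imbalance k f ∣ ∣ imbalance k l ∣ (≤ᵇ-true⇒≤ _ k adm-f) (≤ᵇ-true⇒≤ _ k adm-l)
             (imbalance-gap k f l c f+c≤l)

-- Linear growth beats the window: if p c² ≤ 2h+1 with h = v + t, then
-- p q (c+1)² < p (3h+1), provided 4q ≤ 3p and the inequality holds at t = 0
-- with room for the term 2pq.
window-vs-growth : ∀ p q v t c → 4 * q ≤ 3 * p → (2 * q) * suc (v + v) + p * (q * 2) < p * (3 * v + 1) →
  p * (c * c) ≤ suc ((v + t) + (v + t)) → p * (q * (suc c * suc c)) < p * (3 * (v + t) + 1)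
window-vs-growth p q v t c 4q≤3p base window = begin-strict
  p * (q * (suc c * suc c))                        ≤⟨ *-monoʳ-≤ p (*-monoʳ-≤ q (square-sum≤ 1 c)) ⟩
  p * (q * (2 * (1 * 1 + c * c)))                  ≡⟨ expand p q c ⟩
  (2 * q) * (p * (c * c)) + p * (q * 2)            ≤⟨ +-monoˡ-≤ (p * (q * 2)) (*-monoʳ-≤ (2 * q) window) ⟩
  (2 * q) * suc ((v + t) + (v + t)) + p * (q * 2)  ≡⟨ split-t q v t (p * (q * 2)) ⟩
  (4 * q) * t + ((2 * q) * suc (v + v) + p * (q * 2)) <⟨ +-mono-≤-< (*-monoˡ-≤ t 4q≤3p) base ⟩
  (3 * p) * t + p * (3 * v + 1)                    ≡⟨ collect p v t ⟩
  p * (3 * (v + t) + 1)                            ∎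
  where
  open ≤-Reasoning
  expand : ∀ p q c → p * (q * (2 * (1 * 1 + c * c))) ≡ (2 * q) * (p * (c * c)) + p * (q * 2)
  expand = solve-∀
  split-t : ∀ q v t d → (2 * q) * suc ((v + t) + (v + t)) + d ≡ (4 * q) * t + ((2 * q) * suc (v + v) + d)
  split-t = solve-∀
  collect : ∀ p v t → (3 * p) * t + p * (3 * v + 1) ≡ p * (3 * (v + t) + 1)
  collect = solve-∀

window-small : ∀ h c → 1200 ≤ h → 400 * (c * c) ≤ suc (h + h) → 256 * (suc c * suc c) < 3 * h + 1
window-small h c 1200≤h = subst (λ h → 400 * (c * c) ≤ suc (h + h) → 256 * (suc c * suc c) < 3 * h + 1)
  (m+[n∸m]≡n 1200≤h)
  (λ window → *-cancelˡ-< 400 _ _ (window-vs-growth 400 256 1200 (h ∸ 1200) c (m≤m+n 1024 176) (m≤m+n 1434113 6287) window))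

^-distribʳ-* : ∀ x y m → (x * y) ^ m ≡ x ^ m * y ^ m
^-distribʳ-* x y zero    = refl
^-distribʳ-* x y (suc m) rewrite ^-distribʳ-* x y m = interchange x y (x ^ m) (y ^ m)
  where
  interchange : ∀ x y a b → x * y * (a * b) ≡ x * a * (y * b)
  interchange = solve-∀

square-cancel-< : ∀ x y → x * x < y * y → x < y
square-cancel-< x y x²<y² with x <? y
... | yes x<y = x<y
... | no  x≮y = ⊥-elim (<⇒≱ x²<y² (*-mono-≤ (≮⇒≥ x≮y) (≮⇒≥ x≮y)))

-- 16 (c+1) C(2h,h) < 4^h: square both sides and use the central binomial bound.
scaled-central<4^h : ∀ h c → 1200 ≤ h → 400 * (c * c) ≤ suc (h + h) → 16 * suc c * central h < 4 ^ h
scaled-central<4^h h c 1200≤h window = square-cancel-< _ _ (begin-strict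
  16 * suc c * B * (16 * suc c * B)   ≡⟨ regroup 16 (suc c) B ⟩
  256 * (suc c * suc c) * (B * B)     <⟨ *-monoˡ-< (B * B) {{nonZero}} (window-small h c 1200≤h window) ⟩
  (3 * h + 1) * (B * B)               ≡⟨ *-comm (3 * h + 1) (B * B) ⟩
  B * B * (3 * h + 1)                 ≤⟨ central-bound h ⟩
  16 ^ h                              ≡⟨ ^-distribʳ-* 4 4 h ⟩
  4 ^ h * 4 ^ h                       ∎)
  where
  open ≤-Reasoning
  B = central h
  B≢0 : NonZero B
  B≢0 = >-nonZero (binom-pos (h + h) h (m≤n+m h h))
  nonZero : NonZero (B * B)
  nonZero = m*n≢0 B B {{B≢0}} {{B≢0}}
  regroup : ∀ p c B → p * c * B * (p * c * B) ≡ (p * p) * (c * c) * (B * B)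
  regroup = solve-∀

half-bounds : ∀ k h → (k ≡ h + h) ⊎ (k ≡ suc (h + h)) → h + h ≤ k × k ≤ suc (h + h)
half-bounds k h (inj₁ refl) = ≤-refl , n≤1+n _
half-bounds k h (inj₂ refl) = n≤1+n _ , ≤-refl

half-large : ∀ k h → 3000 ≤ k → k ≤ suc (h + h) → 1200 ≤ h
half-large k h 3000≤k k≤2h+1 with 1200 ≤? h
... | yes 1200≤h = 1200≤h
... | no  1200≰h =
  let h≤1199 = ≤-pred (≰⇒> 1200≰h) in
  ⊥-elim (<⇒≱ (m≤m+n 2400 600) (≤-trans 3000≤k (≤-trans k≤2h+1 (s≤s (+-mono-≤ h≤1199 h≤1199)))))

4^half≤2^ : ∀ k h → h + h ≤ k → 4 ^ h ≤ 2 ^ k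
4^half≤2^ k h 2h≤k = begin
  4 ^ h         ≡⟨ ^-distribʳ-* 2 2 h ⟩
  2 ^ h * 2 ^ h ≡⟨ ^-distribˡ-+-* 2 h h ⟨
  2 ^ (h + h)   ≤⟨ ^-monoʳ-≤ 2 2h≤k ⟩
  2 ^ k         ∎
  where open ≤-Reasoning

balancedCount : ℕ → ℕ
balancedCount k = cubeSum k (λ y → 𝟙 (balanced k y))

admissibleCount : ℕ → ℕ
admissibleCount k = rangeSum (suc k) (λ w → 𝟙 (admissible k w))

-- Each admissible weight is carried by at most 2·C(2h,h) vectors.
balancedCount-≤ : ∀ k h → (k ≡ h + h) ⊎ (k ≡ suc (h + h)) → balancedCount k ≤ admissibleCount k * (2 * central h)
balancedCount-≤ k h k≈2h = begin
    balancedCount k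
  ≡⟨ cubeSum-cong k (λ y → cong 𝟙 (balanced-falses k y)) ⟩
    cubeSum k (λ y → 𝟙 (admissible k (falses y)))
  ≡⟨ weight-distribution k (admissible k) (suc k) ≤-refl ⟩
    rangeSum (suc k) (λ w → 𝟙 (admissible k w) * binom k w)
  ≤⟨ rangeSum-mono (suc k) (λ w → *-monoʳ-≤ (𝟙 (admissible k w)) (binom-max k h k≈2h w)) ⟩
    rangeSum (suc k) (λ w → 𝟙 (admissible k w) * (2 * central h))
  ≡⟨ rangeSum-*ʳ (suc k) (λ w → 𝟙 (admissible k w)) _ ⟩
    admissibleCount k * (2 * central h)
  ∎
  where open ≤-Reasoning

anticoncentration : ∀ k → 3000 ≤ k → 8 * balancedCount k < 2 ^ k
anticoncentration k 3000≤k with half k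
... | h , k≈2h with admissibleCount k in count-eq | balancedCount-≤ k h k≈2h
...   | zero  | s₀≤ = ≤-<-trans (*-monoʳ-≤ 8 s₀≤) (m^n>0 2 k)
...   | suc c | s₀≤ = begin-strict
  8 * balancedCount k             ≤⟨ *-monoʳ-≤ 8 s₀≤ ⟩
  8 * (suc c * (2 * central h))   ≡⟨ regroup (suc c) (central h) ⟩
  16 * suc c * central h          <⟨ scaled-central<4^h h c (half-large k h 3000≤k (proj₂ (half-bounds k h k≈2h))) window ⟩
  4 ^ h                           ≤⟨ 4^half≤2^ k h (proj₁ (half-bounds k h k≈2h)) ⟩
  2 ^ k                           ∎
  where
  open ≤-Reasoning
  regroup : ∀ c x → 8 * (c * (2 * x)) ≡ 16 * c * x
  regroup = solve-∀
  window : 400 * (c * c) ≤ suc (h + h)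
  window = let (f , l , adm-f , adm-l , f+c≤l) = spread (suc k) (admissible k) c count-eq in
           ≤-trans (admissible-window k f l c adm-f adm-l f+c≤l) (proj₂ (half-bounds k h k≈2h))

times : Bool → Bool → Bool
times true  b = b
times false b = not b

sign-times : ∀ a b → sign a ℤ.* sign b ≡ sign (times a b)
sign-times true  true  = refl
sign-times true  false = refl
sign-times false true  = refl
sign-times false false = refl

cubeSum-translate : ∀ k (x : Vec Bool k) (g : Vec Bool k → ℕ) → cubeSum k (λ c → g (zipWith times x c)) ≡ cubeSum k g
cubeSum-translate zero    []          g = refl
cubeSum-translate (suc k) (true ∷ x)  g =
  cong₂ _+_ (cubeSum-translate k x (λ v → g (true ∷ v))) (cubeSum-translate k x (λ v → g (false ∷ v)))
cubeSum-translate (suc k) (false ∷ x) g =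
  trans (cong₂ _+_ (cubeSum-translate k x (λ v → g (false ∷ v))) (cubeSum-translate k x (λ v → g (true ∷ v))))
        (+-comm (cubeSum k (λ v → g (false ∷ v))) _)

dot-signSum : ∀ {k} (u v : Vec Bool k) →
  sumℤ k (λ i → sign (lookup u i) ℤ.* sign (lookup v i)) ≡ signSum (zipWith times u v)
dot-signSum []      []      = refl
dot-signSum (a ∷ u) (b ∷ v) = cong₂ ℤ._+_ (sign-times a b) (dot-signSum u v)

smallFor : ∀ {k} → Vec Bool k → Vec Bool k → Bool
smallFor {k} x c = balanced k (zipWith times x c)

badCount : ∀ k m → Vec (Vec Bool k) k → ℕ
badCount k m cs = cubeSum k (λ x → 𝟙 (m ≤ᵇ hits (smallFor x) cs))

-- First moment: by translation invariance every x has s₀ small columns, so the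
-- union bound applies uniformly in x.
badCount-total : ∀ k m →
  (2 ^ k) ^ m * tupleSum k k (badCount k m) ≤ 2 ^ k * (2 ^ k * balancedCount k ^ m * (2 ^ k) ^ k)
badCount-total k m = begin
    a ^ m * tupleSum k k (badCount k m)
  ≡⟨ cong (a ^ m *_) (tupleSum-comm k k k (λ x cs → 𝟙 (m ≤ᵇ hits (smallFor x) cs))) ⟩
    a ^ m * cubeSum k (λ x → atLeast k k (smallFor x) m)
  ≡⟨ trans (*-comm (a ^ m) _) (sym (cubeSum-*ʳ k (λ x → atLeast k k (smallFor x) m) (a ^ m))) ⟩
    cubeSum k (λ x → atLeast k k (smallFor x) m * a ^ m)
  ≤⟨ cubeSum-mono k per-x ⟩
    cubeSum k (λ _ → 2 ^ k * s₀ ^ m * a ^ k)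
  ≡⟨ cubeSum-const k _ ⟩
    2 ^ k * (2 ^ k * s₀ ^ m * a ^ k)
  ∎
  where
  open ≤-Reasoning
  a  = 2 ^ k
  s₀ = balancedCount k
  per-x : ∀ x → atLeast k k (smallFor x) m * a ^ m ≤ 2 ^ k * s₀ ^ m * a ^ k
  per-x x = begin
    atLeast k k (smallFor x) m * a ^ m                                  ≡⟨ *-comm _ (a ^ m) ⟩
    a ^ m * atLeast k k (smallFor x) m                                  ≤⟨ atLeast-bound k k (smallFor x) m ⟩
    2 ^ k * cubeSum k (λ c → 𝟙 (smallFor x c)) ^ m * a ^ k              ≡⟨ cong (λ t → 2 ^ k * t ^ m * a ^ k)
                                                                             (cubeSum-translate k x (λ y → 𝟙 (balanced k y))) ⟩
    2 ^ k * s₀ ^ m * a ^ k                                              ∎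

-- When 2k ≤ 3m and 8 s₀ < 2^k the first moment is below the number (2^k)^k of tuples:
-- 2^k · 2^k · s₀^m ≤ (8 s₀)^m < (2^k)^m.
first-moment-small : ∀ k m s₀ → .{{_ : NonZero m}} → 2 * k ≤ 3 * m → 8 * s₀ < 2 ^ k →
  2 ^ k * (2 ^ k * s₀ ^ m * (2 ^ k) ^ k) < (2 ^ k) ^ m * ((2 ^ k) ^ k * 1)
first-moment-small k m s₀ 2k≤3m 8s₀<2^k = begin-strict
  2 ^ k * (2 ^ k * s₀ ^ m * A)  ≡⟨ regroup (2 ^ k) (s₀ ^ m) A ⟩
  (2 ^ k * 2 ^ k) * s₀ ^ m * A  ≡⟨ cong (λ t → t * s₀ ^ m * A) (^-distribˡ-+-* 2 k k) ⟨
  2 ^ (k + k) * s₀ ^ m * A      ≤⟨ *-monoˡ-≤ A (*-monoˡ-≤ (s₀ ^ m) (^-monoʳ-≤ 2 k+k≤3m)) ⟩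
  2 ^ (3 * m) * s₀ ^ m * A      ≡⟨ cong (λ t → t * s₀ ^ m * A) (^-*-assoc 2 3 m) ⟨
  8 ^ m * s₀ ^ m * A            ≡⟨ cong (_* A) (^-distribʳ-* 8 s₀ m) ⟨
  (8 * s₀) ^ m * A              <⟨ *-monoˡ-< A {{A≢0}} (^-monoˡ-< m 8s₀<2^k) ⟩
  (2 ^ k) ^ m * A               ≡⟨ cong ((2 ^ k) ^ m *_) (*-identityʳ A) ⟨
  (2 ^ k) ^ m * (A * 1)         ∎
  where
  open ≤-Reasoning
  A = (2 ^ k) ^ k
  A≢0 : NonZero A
  A≢0 = m^n≢0 (2 ^ k) k {{m^n≢0 2 k}}
  k+k≤3m : k + k ≤ 3 * m
  k+k≤3m = subst (_≤ 3 * m) (cong (_+_ k) (+-identityʳ k)) 2k≤3m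
  regroup : ∀ p s a → p * (p * s * a) ≡ (p * p) * s * a
  regroup = solve-∀

good-columns : ∀ k m → .{{_ : NonZero m}} → 3000 ≤ k → 2 * k ≤ 3 * m →
  Σ (Vec (Vec Bool k) k) λ cs → ∀ x → hits (smallFor x) cs < m
good-columns k m 3000≤k 2k≤3m =
  let (cs , bad<1) = tupleSum-<⇒small k k (badCount k m) 1 total<tuples
  in cs , λ x → ≤ᵇ-false⇒> m _ (𝟙≡0⇒false (cubeSum-≡0 k _ (n<1⇒n≡0 bad<1) x))
  where
  total<tuples : tupleSum k k (badCount k m) < (2 ^ k) ^ k * 1
  total<tuples = *-cancelˡ-< ((2 ^ k) ^ m) _ _
    (≤-<-trans (badCount-total k m) (first-moment-small k m (balancedCount k) 2k≤3m (anticoncentration k 3000≤k)))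

ceil-third : ∀ n → Σ ℕ λ m → n ≤ 3 * m × 3 * m ≤ n + 2
ceil-third zero = 0 , z≤n , z≤n
ceil-third (suc n) with ceil-third n
... | m , n≤3m , 3m≤n+2 with n <? 3 * m
...   | yes n<3m = m , n<3m , ≤-trans 3m≤n+2 (n≤1+n _)
...   | no  n≮3m = suc m , ≤-trans (m≤n+m (suc n) 2) (≤-reflexive (sym 3m+3)) , ≤-reflexive (trans 3m+3 (+-comm 2 (suc n)))
  where
  3m+3 : 3 * suc m ≡ 3 + n
  3m+3 = trans (*-suc 3 m) (cong (_+_ 3) (≤-antisym (≮⇒≥ n≮3m) n≤3m))

third-nonZero : ∀ k m → 3000 ≤ k → 2 * k ≤ 3 * m → NonZero m
third-nonZero (suc k) (suc m) _ _  = _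
third-nonZero (suc k) zero    _ ()

fromSigns : ∀ {k} (x : Fin k → ℤ) → (∀ i → IsSign (x i)) → Σ (Vec Bool k) λ v → ∀ i → x i ≡ sign (lookup v i)
fromSigns x x-signs = tabulate (λ i → toBool (x-signs i)) , λ i →
  trans (toBool-sign (x-signs i)) (cong sign (sym (lookup∘tabulate (λ i → toBool (x-signs i)) i)))
  where
  toBool : ∀ {z} → IsSign z → Bool
  toBool (inj₁ _) = true
  toBool (inj₂ _) = false
  toBool-sign : ∀ {z} (p : IsSign z) → z ≡ sign (toBool p)
  toBool-sign (inj₁ z≡1)  = z≡1
  toBool-sign (inj₂ z≡-1) = z≡-1

columnMatrix : ∀ {k} → Vec (Vec Bool k) k → Fin k → Fin k → ℤ
columnMatrix cs i j = sign (lookup (lookup cs j) i)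

columnMatrix-signs : ∀ {k} (cs : Vec (Vec Bool k) k) (i j : Fin k) → IsSign (columnMatrix cs i j)
columnMatrix-signs cs i j with lookup (lookup cs j) i
... | true  = inj₁ refl
... | false = inj₂ refl

rowTimes-columnMatrix : ∀ {k} (x : Fin k → ℤ) (v : Vec Bool k) (cs : Vec (Vec Bool k) k) →
  (∀ i → x i ≡ sign (lookup v i)) → ∀ j → rowTimes x (columnMatrix cs) j ≡ signSum (zipWith times v (lookup cs j))
rowTimes-columnMatrix {k} x v cs x≡v j =
  trans (sumℤ-cong k (λ i → cong (ℤ._* columnMatrix cs i j) (x≡v i))) (dot-signSum v (lookup cs j))
  where
  sumℤ-cong : ∀ n {f g : Fin n → ℤ} → (∀ i → f i ≡ g i) → sumℤ n f ≡ sumℤ n g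
  sumℤ-cong zero    f≡g = refl
  sumℤ-cong (suc n) f≡g = cong₂ ℤ._+_ (f≡g zero) (sumℤ-cong n (λ i → f≡g (suc i)))

large⇔unbalanced : ∀ k (y : Vec Bool k) →
  (Large k (signSum y) → balanced k y ≡ false) × (balanced k y ≡ false → Large k (signSum y))
large⇔unbalanced k y = >⇒≤ᵇ-false _ k , ≤ᵇ-false⇒> _ k

count-complement : ∀ {k n} (σ : Vec Bool k → Bool) (cs : Vec (Vec Bool k) n) (P : Fin n → Set) (P? : ∀ j → Dec (P j)) →
  (∀ j → (P j → σ (lookup cs j) ≡ false) × (σ (lookup cs j) ≡ false → P j)) → count P P? + hits σ cs ≡ n
count-complement σ []       P P? P⇔¬σ = refl
count-complement σ (c ∷ cs) P P? P⇔¬σ with P? zero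
... | yes P0 rewrite proj₁ (P⇔¬σ zero) P0 = cong suc (count-complement σ cs _ _ (λ j → P⇔¬σ (suc j)))
... | no ¬P0 with σ c in σc
...   | true  = trans (+-suc _ _) (cong suc (count-complement σ cs _ _ (λ j → P⇔¬σ (suc j))))
...   | false = ⊥-elim (¬P0 (proj₂ (P⇔¬σ zero) σc))

large-plus-small : ∀ {k} (x : Fin k → ℤ) (v : Vec Bool k) (cs : Vec (Vec Bool k) k) → (∀ i → x i ≡ sign (lookup v i)) →
  count (λ j → Large k (rowTimes x (columnMatrix cs) j)) (λ j → Large? k (rowTimes x (columnMatrix cs) j))
    + hits (smallFor v) cs ≡ k
large-plus-small {k} x v cs x≡v = count-complement (smallFor v) cs _ _ λ j →
  let row≡ = rowTimes-columnMatrix x v cs x≡v j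
      (large⇒ , ⇒large) = large⇔unbalanced k (zipWith times v (lookup cs j))
  in (λ large → large⇒ (subst (Large k) row≡ large)) , (λ unbalanced → subst (Large k) (sym row≡) (⇒large unbalanced))

more-than-third : ∀ k c s m → c + s ≡ k → s < m → 3 * m ≤ 2 * k + 2 → k < 3 * c
more-than-third k c s m refl s<m 3m≤ = +-cancelʳ-≤ (2 * (c + s) + 2) (suc (c + s)) (3 * c) (begin
  suc (c + s) + (2 * (c + s) + 2) ≡⟨ regroup c s ⟩
  3 * c + 3 * suc s               ≤⟨ +-monoʳ-≤ (3 * c) (*-monoʳ-≤ 3 s<m) ⟩
  3 * c + 3 * m                   ≤⟨ +-monoʳ-≤ (3 * c) 3m≤ ⟩
  3 * c + (2 * (c + s) + 2)       ∎)
  where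
  open ≤-Reasoning
  regroup : ∀ c s → suc (c + s) + (2 * (c + s) + 2) ≡ 3 * c + 3 * suc s
  regroup = solve-∀

lemma1 : Σ ℕ λ K → (k : ℕ) → k ≥ K →
    Σ (Fin k → Fin k → ℤ) λ M → ((i j : Fin k) → IsSign (M i j)) ×
    ((x : Fin k → ℤ) → ((i : Fin k) → IsSign (x i)) →
    k < 3 * count (λ j → Large k (rowTimes x M j)) (λ j → Large? k (rowTimes x M j)))
lemma1 = 3000 , λ k 3000≤k →
  let (m , 2k≤3m , 3m≤2k+2) = ceil-third (2 * k)
      (cs , few-small)       = good-columns k m {{third-nonZero k m 3000≤k 2k≤3m}} 3000≤k 2k≤3m
  in columnMatrix cs , columnMatrix-signs cs , λ x x-signs →
       let (v , x≡v) = fromSigns x x-signs in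
       more-than-third k _ _ m (large-plus-small x v cs x≡v) (few-small v) 3m≤2k+2
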